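{- Let $H$ be a finite simple graph and $e=(u,v)\in E(H)$. Then $$\mathrm{wr}(H-e\mid u\in A,\ v\in A)\geq \mathrm{wr}(H-e\mid u\in A,\ v\in C),$$ i.e. the number of Widom-Rowlinson configurations of $H-e$ in which both $u$ and $v$ receive color $a$ is at least the number of those in which $u$ receives color $a$ and $v$ receives color $c$.
   Context: A Widom-Rowlinson configuration of a graph $G$ is a map $\phi:V(G)\to\{a,b,c\}$ such that no edge of $G$ has one endpoint mapped to $a$ and the other to $c$ (equivalently, a homomorphism from $G$ to the path $a-b-c$ with a loop at each vertex). For such $\phi$ write $A=\phi^{ -1}(a)$, $B=\phi^{ -1}(b)$, $C=\phi^{ -1}(c)$, and $\mathrm{wr}(G\mid \text{condition})$ denotes the number of Widom-Rowlinson configurations of $G$ satisfying the condition. $H-e$ is $H$ with the edge $e$ deleted. -}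

module Defs where

open import Data.Nat using (ℕ; zero; suc)
open import Data.Fin using (Fin; zero; suc; _≟_)
open import Data.Bool using (Bool; true; false; _∧_; _∨_; not; if_then_else_)
open import Data.List using (List; []; _∷_; map; concatMap; length; allFin)
open import Relation.Binary.PropositionalEquality using (_≡_)
open import Relation.Nullary using (¬_)
open import Relation.Nullary.Decidable using (⌊_⌋)
open import Relation.Nullary using (Dec; yes; no)

record Graph (n : ℕ) : Set where
  field
    adj   : Fin n → Fin n → Bool
    sym   : ∀ x y → adj x y ≡ adj y x
    irrefl : ∀ x → adj x x ≡ false
open Graph public

isEnd : ∀ {n} → Fin n → Fin n → Fin n → Fin n → Bool
isEnd u v x y = (⌊ x ≟ u ⌋ ∧ ⌊ y ≟ v ⌋) ∨ (⌊ x ≟ v ⌋ ∧ ⌊ y ≟ u ⌋)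

deleteEdgeAdj : ∀ {n} → Graph n → Fin n → Fin n → Fin n → Fin n → Bool
deleteEdgeAdj H u v x y = adj H x y ∧ not (isEnd u v x y)

-- Colours of the target graph a - b - c (loops at each vertex).
data Colour : Set where
  a b c : Colour

forbidden : Colour → Colour → Bool
forbidden a c = true
forbidden c a = true
forbidden _ _ = false

_==ᶜ_ : Colour → Colour → Bool
a ==ᶜ a = true
b ==ᶜ b = true
c ==ᶜ c = true
_ ==ᶜ _ = false

allB : {A : Set} → (A → Bool) → List A → Bool
allB p [] = true
allB p (x ∷ xs) = p x ∧ allB p xs

countB : {A : Set} → (A → Bool) → List A → ℕ
countB p [] = zero
countB p (x ∷ xs) = if p x then suc (countB p xs) else countB p xs

isWR : ∀ {n} → (Fin n → Fin n → Bool) → (Fin n → Colour) → Bool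
isWR {n} G φ = allB (λ x → allB (λ y → not (G x y ∧ forbidden (φ x) (φ y))) (allFin n)) (allFin n)

allMaps : (n : ℕ) → List (Fin n → Colour)
allMaps zero = (λ ()) ∷ []
allMaps (suc n) =
  concatMap (λ col → map (λ φ → λ { zero → col ; (suc i) → φ i }) (allMaps n)) (a ∷ b ∷ c ∷ [])

wrCount : ∀ {n} → (Fin n → Fin n → Bool) → ((Fin n → Colour) → Bool) → ℕ
wrCount {n} G cond = countB (λ φ → isWR G φ ∧ cond φ) (allMaps n)

-- Swap the colours a and c on the component K of v in the subgraph spanned by the vertices not
-- coloured b. In a Widom–Rowlinson configuration such components are monochromatic, and every
-- edge leaving K ends in a vertex coloured b, so the swap yields again a configuration. If u is
-- coloured a and v is coloured c, then u ∉ K and the swap colours both u and v with a. The swap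
-- is an involution, hence injective, which gives the inequality.

module Submission where

open import Defs
open import Data.Bool using (Bool; true; false; T; _∧_; _∨_; not; if_then_else_)
open import Data.Bool.ListAction using (any; or)
open import Data.Bool.Properties using (T-∧; T-∨; T?)
open import Data.Empty using (⊥-elim)
open import Data.Fin using (Fin; zero; suc; _≟_)
open import Data.List using (List; []; _∷_; _++_; [_]; map; length; allFin; filterᵇ; cartesianProductWith)
open import Data.List.Properties using (map-++; map-∘; map-cong; length-map; length-tabulate)
open import Data.List.Membership.Propositional using (_∈_; lose)
open import Data.List.Membership.Propositional.Properties
  using (∈-allFin; ∈-map⁻; ∈-filter⁻; ∈-cartesianProductWith⁺)
open import Data.List.Relation.Binary.Subset.Propositional using (_⊆_)
import Data.List.Relation.Unary.All as All
open All using ([]; _∷_)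
open import Data.List.Relation.Unary.AllPairs using ([]; _∷_)
open import Data.List.Relation.Unary.Any using (here; there; _─_; satisfied)
open import Data.List.Relation.Unary.Any.Properties using (any⁺; any⁻)
open import Data.List.Relation.Unary.Unique.Propositional using (Unique)
import Data.List.Relation.Unary.Unique.Propositional.Properties as Unique
open import Data.Nat using (ℕ; zero; suc; _≤_; _<_; _≥_; z≤n; s≤s)
open import Data.Nat.Properties using (≤-trans; ≤-reflexive; m≤n⇒m≤1+n; 1+n≰n; module ≤-Reasoning)
open import Data.Product using (_×_; _,_; proj₁; proj₂; ∃)
open import Data.Sum using (_⊎_; inj₁; inj₂)
open import Data.Unit using (tt)
open import Data.Vec using (Vec; []; _∷_; lookup; tabulate)
open import Data.Vec.Properties using (lookup∘tabulate; tabulate∘lookup; tabulate-cong; ∷-injective)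
open import Function using (_∘_; id; Equivalence)
open import Function.Definitions using (Injective)
open import Relation.Nullary using (¬_; yes; no)
open import Relation.Nullary.Decidable using (⌊_⌋)
open import Relation.Binary.PropositionalEquality using (_≡_; _≢_; _≗_; refl; trans; cong; cong₂; subst)
import Relation.Binary.PropositionalEquality as ≡

open Equivalence using (to; from)

module _ {A : Set} where

  countB-cong : {p q : A → Bool} → (∀ x → p x ≡ q x) → ∀ xs → countB p xs ≡ countB q xs
  countB-cong p≗q [] = refl
  countB-cong p≗q (x ∷ xs) rewrite p≗q x | countB-cong p≗q xs = refl

  countB-map : {B : Set} (p : B → Bool) (f : A → B) → ∀ xs → countB p (map f xs) ≡ countB (p ∘ f) xs
  countB-map p f [] = refl
  countB-map p f (x ∷ xs) rewrite countB-map p f xs = refl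

  countB≤length : (p : A → Bool) → ∀ xs → countB p xs ≤ length xs
  countB≤length p [] = z≤n
  countB≤length p (x ∷ xs) with p x
  ... | true  = s≤s (countB≤length p xs)
  ... | false = m≤n⇒m≤1+n (countB≤length p xs)

  countB≡length-filterᵇ : (p : A → Bool) → ∀ xs → countB p xs ≡ length (filterᵇ p xs)
  countB≡length-filterᵇ p [] = refl
  countB≡length-filterᵇ p (x ∷ xs) with p x
  ... | true  = cong suc (countB≡length-filterᵇ p xs)
  ... | false = countB≡length-filterᵇ p xs

  countB-mono : {p q : A → Bool} → (∀ x → T (p x) → T (q x)) → ∀ xs → countB p xs ≤ countB q xs
  countB-mono p⊆q [] = z≤n
  countB-mono {p} {q} p⊆q (x ∷ xs) with p x | q x | p⊆q x
  ... | true  | true  | _ = s≤s (countB-mono p⊆q xs)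
  ... | true  | false | h = ⊥-elim (h tt)
  ... | false | true  | _ = m≤n⇒m≤1+n (countB-mono p⊆q xs)
  ... | false | false | _ = countB-mono p⊆q xs

  countB-<-or-⊇ : {p q : A → Bool} → (∀ x → T (p x) → T (q x)) → ∀ xs →
                  countB p xs < countB q xs ⊎ (∀ {x} → x ∈ xs → T (q x) → T (p x))
  countB-<-or-⊇ p⊆q [] = inj₂ λ ()
  countB-<-or-⊇ {p} {q} p⊆q (x ∷ xs) with p x in px | q x in qx | p⊆q x | countB-<-or-⊇ p⊆q xs
  ... | true  | false | h | _        = ⊥-elim (h tt)
  ... | false | true  | _ | _        = inj₁ (s≤s (countB-mono p⊆q xs))
  ... | true  | true  | _ | inj₁ p<q = inj₁ (s≤s p<q)
  ... | false | false | _ | inj₁ p<q = inj₁ p<q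
  ... | true  | true  | _ | inj₂ q⊆p = inj₂ λ { (here refl) _ → subst T (≡.sym px) tt ; (there y∈xs) → q⊆p y∈xs }
  ... | false | false | _ | inj₂ q⊆p = inj₂ λ { (here refl) qy → ⊥-elim (subst T qx qy) ; (there y∈xs) → q⊆p y∈xs }

  countB-─ : (q : A → Bool) {x : A} {ys : List A} (x∈ys : x ∈ ys) → T (q x) → countB q ys ≡ suc (countB q (ys ─ x∈ys))
  countB-─ q {x} (here refl) qx with q x | qx
  ... | true | _ = refl
  countB-─ q {ys = y ∷ ys} (there x∈ys) qx with q y
  ... | true  = cong suc (countB-─ q x∈ys qx)
  ... | false = countB-─ q x∈ys qx

  ∈-─ : {x y : A} {ys : List A} (x∈ys : x ∈ ys) → y ∈ ys → x ≢ y → y ∈ (ys ─ x∈ys)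
  ∈-─ (here refl) (here refl)  x≢y = ⊥-elim (x≢y refl)
  ∈-─ (here refl) (there y∈ys) _   = y∈ys
  ∈-─ (there _)   (here refl)  _   = here refl
  ∈-─ (there x∈ys) (there y∈ys) x≢y = there (∈-─ x∈ys y∈ys x≢y)

  length≤countB : (q : A → Bool) {xs ys : List A} → Unique xs → xs ⊆ ys →
                  (∀ {x} → x ∈ xs → T (q x)) → length xs ≤ countB q ys
  length≤countB q {[]} _ _ _ = z≤n
  length≤countB q {x ∷ xs} {ys} (x∉xs ∷ xs-unique) xs⊆ys q-xs = begin
    suc (length xs)             ≤⟨ s≤s (length≤countB q xs-unique xs⊆ys─x (q-xs ∘ there)) ⟩
    suc (countB q (ys ─ x∈ys))  ≡⟨ ≡.sym (countB-─ q x∈ys (q-xs (here refl))) ⟩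
    countB q ys                 ∎
    where
    open ≤-Reasoning
    x∈ys = xs⊆ys (here refl)
    xs⊆ys─x : xs ⊆ (ys ─ x∈ys)
    xs⊆ys─x y∈xs = ∈-─ x∈ys (xs⊆ys (there y∈xs)) (All.lookup x∉xs y∈xs)

  countB-≤-injection : {p q : A → Bool} {xs : List A} (f : A → A) → Injective _≡_ _≡_ f →
                       Unique xs → (∀ x → x ∈ xs) → (∀ x → T (p x) → T (q (f x))) →
                       countB p xs ≤ countB q xs
  countB-≤-injection {p} {q} {xs} f f-injective xs-unique xs-complete p⇒q∘f = begin
    countB p xs                   ≡⟨ countB≡length-filterᵇ p xs ⟩
    length (filterᵇ p xs)         ≡⟨ ≡.sym (length-map f (filterᵇ p xs)) ⟩
    length (map f (filterᵇ p xs)) ≤⟨ length≤countB q images-unique (λ _ → xs-complete _) q-images ⟩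
    countB q xs                   ∎
    where
    open ≤-Reasoning
    images-unique : Unique (map f (filterᵇ p xs))
    images-unique = Unique.map⁺ f-injective (Unique.filter⁺ (T? ∘ p) xs-unique)
    q-images : ∀ {y} → y ∈ map f (filterᵇ p xs) → T (q y)
    q-images y∈images with ∈-map⁻ f y∈images
    ... | x , x∈filter , refl = p⇒q∘f x (proj₂ (∈-filter⁻ (T? ∘ p) {xs = xs} x∈filter))

colours : List Colour
colours = a ∷ b ∷ c ∷ []

∈-colours : ∀ col → col ∈ colours
∈-colours a = here refl
∈-colours b = there (here refl)
∈-colours c = there (there (here refl))

colours-unique : Unique colours
colours-unique = ((λ ()) ∷ (λ ()) ∷ []) ∷ ((λ ()) ∷ []) ∷ [] ∷ []

vectors : ∀ n → List (Vec Colour n)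
vectors zero    = [ [] ]
vectors (suc n) = cartesianProductWith _∷_ colours (vectors n)

∈-vectors : ∀ {n} (w : Vec Colour n) → w ∈ vectors n
∈-vectors []        = here refl
∈-vectors (col ∷ w) = ∈-cartesianProductWith⁺ _∷_ (∈-colours col) (∈-vectors w)

vectors-unique : ∀ n → Unique (vectors n)
vectors-unique zero    = [] ∷ []
vectors-unique (suc n) = Unique.cartesianProductWith⁺ _∷_ ∷-injective colours-unique (vectors-unique n)

map-tabulate-extend : ∀ {n} (col : Colour) (g : (Fin n → Colour) → Fin (suc n) → Colour) →
                      (∀ φ → tabulate (g φ) ≡ col ∷ tabulate φ) → ∀ M →
                      map tabulate (map g M) ≡ map (col ∷_) (map tabulate M)
map-tabulate-extend col g tabulate-g M =
  trans (≡.sym (map-∘ M)) (trans (map-cong tabulate-g M) (map-∘ M))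

-- allMaps (suc n) is built from anonymous pattern lambdas, which no lemma can name, so each of its
-- three blocks is matched by unification separately.
tabulate-allMaps : ∀ n → map tabulate (allMaps n) ≡ vectors n
tabulate-allMaps zero = refl
tabulate-allMaps (suc n) rewrite ≡.sym (tabulate-allMaps n) =
  trans (map-++ tabulate (map _ (allMaps n)) _) (cong₂ _++_ (map-tabulate-extend a _ (λ _ → refl) (allMaps n))
  (trans (map-++ tabulate (map _ (allMaps n)) _) (cong₂ _++_ (map-tabulate-extend b _ (λ _ → refl) (allMaps n))
  (trans (map-++ tabulate (map _ (allMaps n)) _) (cong₂ _++_ (map-tabulate-extend c _ (λ _ → refl) (allMaps n))
  refl)))))

Respects≗ : ∀ {n} → ((Fin n → Colour) → Bool) → Set
Respects≗ p = ∀ {φ ψ} → φ ≗ ψ → p φ ≡ p ψ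

countB-allMaps≡countB-vectors : ∀ {n} (p : (Fin n → Colour) → Bool) → Respects≗ p →
                                countB p (allMaps n) ≡ countB (p ∘ lookup) (vectors n)
countB-allMaps≡countB-vectors {n} p p-resp = begin
  countB p (allMaps n)                           ≡⟨ countB-cong (λ φ → p-resp (≡.sym ∘ lookup∘tabulate φ)) (allMaps n) ⟩
  countB (p ∘ lookup ∘ tabulate) (allMaps n)     ≡⟨ ≡.sym (countB-map (p ∘ lookup) tabulate (allMaps n)) ⟩
  countB (p ∘ lookup) (map tabulate (allMaps n)) ≡⟨ cong (countB (p ∘ lookup)) (tabulate-allMaps n) ⟩
  countB (p ∘ lookup) (vectors n)                ∎
  where open ≡.≡-Reasoning

countB-allMaps-≤ : ∀ {n} {p q : (Fin n → Colour) → Bool} (f : (Fin n → Colour) → Fin n → Colour) →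
                   Injective _≗_ _≗_ f → Respects≗ p → Respects≗ q → (∀ φ → T (p φ) → T (q (f φ))) →
                   countB p (allMaps n) ≤ countB q (allMaps n)
countB-allMaps-≤ {n} {p} {q} f f-injective p-resp q-resp p⇒q∘f = begin
  countB p (allMaps n)            ≡⟨ countB-allMaps≡countB-vectors p p-resp ⟩
  countB (p ∘ lookup) (vectors n) ≤⟨ countB-≤-injection F F-injective (vectors-unique n) ∈-vectors p⇒q∘F ⟩
  countB (q ∘ lookup) (vectors n) ≡⟨ ≡.sym (countB-allMaps≡countB-vectors q q-resp) ⟩
  countB q (allMaps n)            ∎
  where
  open ≤-Reasoning
  F : Vec Colour n → Vec Colour n
  F = tabulate ∘ f ∘ lookup
  F-injective : Injective _≡_ _≡_ F
  F-injective {w} {w′} Fw≡Fw′ =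
    trans (≡.sym (tabulate∘lookup w)) (trans (tabulate-cong (f-injective f∘lookup-agree)) (tabulate∘lookup w′))
    where
    f∘lookup-agree : f (lookup w) ≗ f (lookup w′)
    f∘lookup-agree i = trans (≡.sym (lookup∘tabulate (f (lookup w)) i))
                             (trans (cong (λ z → lookup z i) Fw≡Fw′) (lookup∘tabulate (f (lookup w′)) i))
  p⇒q∘F : ∀ w → T (p (lookup w)) → T (q (lookup (F w)))
  p⇒q∘F w pw = subst T (q-resp (≡.sym ∘ lookup∘tabulate (f (lookup w)))) (p⇒q∘f (lookup w) pw)

module _ {n : ℕ} where

  reach : (Fin n → Fin n → Bool) → Fin n → ℕ → Fin n → Bool
  reach E v zero    x = ⌊ x ≟ v ⌋
  reach E v (suc k) x = reach E v k x ∨ any (λ y → reach E v k y ∧ E y x) (allFin n)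

  component : (Fin n → Fin n → Bool) → Fin n → Fin n → Bool
  component E v = reach E v (suc n)

  module _ {E : Fin n → Fin n → Bool} {v : Fin n} where

    reach-source : ∀ k → T (reach E v k v)
    reach-source zero with v ≟ v
    ... | yes _   = tt
    ... | no v≢v  = v≢v refl
    reach-source (suc k) = from T-∨ (inj₁ (reach-source k))

    reach-mono : ∀ k x → T (reach E v k x) → T (reach E v (suc k) x)
    reach-mono _ _ = from T-∨ ∘ inj₁

    reach-step : ∀ k {x y} → T (reach E v k y) → T (E y x) → T (reach E v (suc k) x)
    reach-step _ {y = y} ry e =
      from T-∨ (inj₂ (any⁺ _ (lose (∈-allFin y) (from T-∧ (ry , e)))))

    reach-suc⁻ : ∀ k {x} → T (reach E v (suc k) x) →
                 T (reach E v k x) ⊎ ∃ λ y → T (reach E v k y) × T (E y x)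
    reach-suc⁻ k r with to T-∨ r
    ... | inj₁ rx  = inj₁ rx
    ... | inj₂ any-y with satisfied (any⁻ _ (allFin n) any-y)
    ...   | y , rye = inj₂ (y , to T-∧ rye)

    reach-induction : (P : Fin n → Set) → P v → (∀ {y x} → P y → T (E y x) → P x) →
                      ∀ k {x} → T (reach E v k x) → P x
    reach-induction P Pv step zero {x} r with x ≟ v
    ... | yes refl = Pv
    reach-induction P Pv step (suc k) r with reach-suc⁻ k r
    ... | inj₁ rx            = reach-induction P Pv step k rx
    ... | inj₂ (y , ry , e)  = step (reach-induction P Pv step k ry) e

    ClosedAt : ℕ → Set
    ClosedAt k = ∀ {x} → T (reach E v (suc k) x) → T (reach E v k x)

    closedAt-suc : ∀ k → ClosedAt k → ClosedAt (suc k)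
    closedAt-suc k closed r with reach-suc⁻ (suc k) r
    ... | inj₁ rx           = rx
    ... | inj₂ (y , ry , e) = reach-step k (closed ry) e

    -- Until the iteration stabilises, every step adds a vertex.
    closedAt-or-large : ∀ k → ClosedAt k ⊎ k ≤ countB (reach E v k) (allFin n)
    closedAt-or-large zero = inj₂ z≤n
    closedAt-or-large (suc k) with closedAt-or-large k
    ... | inj₁ closed = inj₁ (closedAt-suc k closed)
    ... | inj₂ k≤size with countB-<-or-⊇ (reach-mono k) (allFin n)
    ...   | inj₁ grows   = inj₂ (≤-trans (s≤s k≤size) grows)
    ...   | inj₂ shrinks = inj₁ (closedAt-suc k λ {x} → shrinks (∈-allFin x))

    closedAt-component : ClosedAt (suc n)
    closedAt-component with closedAt-or-large (suc n)
    ... | inj₁ closed = closed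
    ... | inj₂ large  = ⊥-elim (1+n≰n (≤-trans large (≤-trans (countB≤length _ (allFin n))
                                                           (≤-reflexive (length-tabulate id)))))

    component-source : T (component E v v)
    component-source = reach-source (suc n)

    component-closed : ∀ {x y} → T (component E v y) → T (E y x) → T (component E v x)
    component-closed ry e = closedAt-component (reach-step (suc n) ry e)

    component-induction : (P : Fin n → Set) → P v → (∀ {y x} → P y → T (E y x) → P x) →
                          ∀ {x} → T (component E v x) → P x
    component-induction P Pv step = reach-induction P Pv step (suc n)

  reach-cong : ∀ {E E′ : Fin n → Fin n → Bool} {v} → (∀ x y → E x y ≡ E′ x y) →
               ∀ k x → reach E v k x ≡ reach E′ v k x
  reach-cong E≡E′ zero    x = refl
  reach-cong E≡E′ (suc k) x = cong₂ _∨_ (reach-cong E≡E′ k x)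
    (cong or (map-cong (λ y → cong₂ _∧_ (reach-cong E≡E′ k y) (E≡E′ y x)) (allFin n)))

  component-cong : ∀ {E E′ : Fin n → Fin n → Bool} {v} → (∀ x y → E x y ≡ E′ x y) →
                   ∀ x → component E v x ≡ component E′ v x
  component-cong E≡E′ = reach-cong E≡E′ (suc n)

isAC : Colour → Bool
isAC b = false
isAC _ = true

swapAC : Colour → Colour
swapAC a = c
swapAC b = b
swapAC c = a

swapAC-involutive : ∀ p → swapAC (swapAC p) ≡ p
swapAC-involutive a = refl
swapAC-involutive b = refl
swapAC-involutive c = refl

isAC-swapAC : ∀ p → isAC (swapAC p) ≡ isAC p
isAC-swapAC a = refl
isAC-swapAC b = refl
isAC-swapAC c = refl

forbidden-swapAC : ∀ p q → forbidden (swapAC p) (swapAC q) ≡ forbidden p q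
forbidden-swapAC a a = refl
forbidden-swapAC a b = refl
forbidden-swapAC a c = refl
forbidden-swapAC b _ = refl
forbidden-swapAC c a = refl
forbidden-swapAC c b = refl
forbidden-swapAC c c = refl

forbidden-sym : ∀ p q → forbidden p q ≡ forbidden q p
forbidden-sym a a = refl
forbidden-sym a b = refl
forbidden-sym a c = refl
forbidden-sym b a = refl
forbidden-sym b b = refl
forbidden-sym b c = refl
forbidden-sym c a = refl
forbidden-sym c b = refl
forbidden-sym c c = refl

forbidden⇒isAC : ∀ p q → T (forbidden p q) → T (isAC p) × T (isAC q)
forbidden⇒isAC a c _ = tt , tt
forbidden⇒isAC c a _ = tt , tt

isAC-compatible⇒≡ : ∀ p q → T (isAC p) → T (isAC q) → ¬ T (forbidden p q) → p ≡ q
isAC-compatible⇒≡ a a _ _ _ = refl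
isAC-compatible⇒≡ a c _ _ f = ⊥-elim (f tt)
isAC-compatible⇒≡ c a _ _ f = ⊥-elim (f tt)
isAC-compatible⇒≡ c c _ _ _ = refl

==ᶜ⇒≡ : ∀ p q → T (p ==ᶜ q) → p ≡ q
==ᶜ⇒≡ a a _ = refl
==ᶜ⇒≡ b b _ = refl
==ᶜ⇒≡ c c _ = refl

T-not⇒¬T : ∀ {x} → T (not x) → ¬ T x
T-not⇒¬T {false} _ ()

¬T⇒T-not : ∀ {x} → ¬ T x → T (not x)
¬T⇒T-not {true}  ¬x = ¬x tt
¬T⇒T-not {false} _  = tt

module _ {A : Set} {p : A → Bool} where

  allB⁺ : (∀ x → T (p x)) → ∀ xs → T (allB p xs)
  allB⁺ all-p []       = tt
  allB⁺ all-p (x ∷ xs) = from T-∧ (all-p x , allB⁺ all-p xs)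

  allB⁻ : ∀ {x xs} → T (allB p xs) → x ∈ xs → T (p x)
  allB⁻ {xs = _ ∷ _} all-p (here refl)  = proj₁ (to T-∧ all-p)
  allB⁻ {xs = _ ∷ _} all-p (there x∈xs) = allB⁻ (proj₂ (to T-∧ all-p)) x∈xs

allB-cong : ∀ {A : Set} {p q : A → Bool} → (∀ x → p x ≡ q x) → ∀ xs → allB p xs ≡ allB q xs
allB-cong p≗q []       = refl
allB-cong p≗q (x ∷ xs) = cong₂ _∧_ (p≗q x) (allB-cong p≗q xs)

module _ {n : ℕ} (G : Fin n → Fin n → Bool) where

  isWR⁺ : ∀ {φ} → (∀ x y → T (G x y) → ¬ T (forbidden (φ x) (φ y))) → T (isWR G φ)
  isWR⁺ compatible = allB⁺ (λ x → allB⁺ (λ y → ¬T⇒T-not λ Gxy∧f →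
    let Gxy , f = to T-∧ Gxy∧f in compatible x y Gxy f) (allFin n)) (allFin n)

  isWR⁻ : ∀ {φ x y} → T (isWR G φ) → T (G x y ∨ G y x) → ¬ T (forbidden (φ x) (φ y))
  isWR⁻ {φ} {x} {y} wr adjacent with to T-∨ adjacent
  ... | inj₁ Gxy = λ f → T-not⇒¬T (allB⁻ (allB⁻ wr (∈-allFin x)) (∈-allFin y)) (from T-∧ (Gxy , f))
  ... | inj₂ Gyx = λ f → T-not⇒¬T (allB⁻ (allB⁻ wr (∈-allFin y)) (∈-allFin x))
                                  (from T-∧ (Gyx , subst T (forbidden-sym (φ x) (φ y)) f))

  isWR-resp-≗ : ∀ {φ ψ} → φ ≗ ψ → isWR G φ ≡ isWR G ψ
  isWR-resp-≗ φ≗ψ = allB-cong (λ x → allB-cong (λ y →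
    cong (λ f → not (G x y ∧ f)) (cong₂ forbidden (φ≗ψ x) (φ≗ψ y))) (allFin n)) (allFin n)

  acLink : (Fin n → Colour) → Fin n → Fin n → Bool
  acLink φ x y = (G x y ∨ G y x) ∧ (isAC (φ x) ∧ isAC (φ y))

  acComponent : (Fin n → Colour) → Fin n → Fin n → Bool
  acComponent φ = component (acLink φ)

  acComponent-monochromatic : ∀ {φ v x} → T (isWR G φ) → T (acComponent φ v x) → φ x ≡ φ v
  acComponent-monochromatic {φ} {v} wr =
    component-induction {E = acLink φ} {v} (λ x → φ x ≡ φ v) refl λ {y} {x} φy≡φv link →
      let adjacent , acy∧acx = to T-∧ link
          acy , acx = to T-∧ acy∧acx
      in trans (≡.sym (isAC-compatible⇒≡ (φ y) (φ x) acy acx (isWR⁻ wr adjacent))) φy≡φv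

  acComponent-resp : ∀ {φ ψ v} → (∀ x → isAC (φ x) ≡ isAC (ψ x)) →
                     ∀ x → acComponent φ v x ≡ acComponent ψ v x
  acComponent-resp same-AC = component-cong λ x y → cong₂ (λ p q → (G x y ∨ G y x) ∧ (p ∧ q)) (same-AC x) (same-AC y)

  swapComponent : Fin n → (Fin n → Colour) → Fin n → Colour
  swapComponent v φ x = if acComponent φ v x then swapAC (φ x) else φ x

  module _ {v : Fin n} {φ : Fin n → Colour} where

    swapComponent-in : ∀ {x} → T (acComponent φ v x) → swapComponent v φ x ≡ swapAC (φ x)
    swapComponent-in {x} in-x with acComponent φ v x | in-x
    ... | true | _ = refl

    swapComponent-out : ∀ {x} → ¬ T (acComponent φ v x) → swapComponent v φ x ≡ φ x
    swapComponent-out {x} out-x with acComponent φ v x | out-x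
    ... | true  | out = ⊥-elim (out tt)
    ... | false | _   = refl

    swapComponent-source : swapComponent v φ v ≡ swapAC (φ v)
    swapComponent-source = swapComponent-in (component-source {E = acLink φ} {v})

    swapComponent-fixes : ∀ {x} → T (isWR G φ) → φ x ≢ φ v → swapComponent v φ x ≡ φ x
    swapComponent-fixes wr φx≢φv = swapComponent-out (φx≢φv ∘ acComponent-monochromatic wr)

    isAC-swapComponent : ∀ x → isAC (swapComponent v φ x) ≡ isAC (φ x)
    isAC-swapComponent x with T? (acComponent φ v x)
    ... | yes in-x  rewrite swapComponent-in in-x = isAC-swapAC (φ x)
    ... | no  out-x rewrite swapComponent-out out-x = refl

    -- The only edges whose compatibility the swap can break leave the component, and such an
    -- edge has an endpoint coloured b, since otherwise it would lie in the component.
    swapComponent-boundary : ∀ {x y} → T (G x y ∨ G y x) → T (acComponent φ v x) → ¬ T (acComponent φ v y) →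
                             ¬ T (forbidden (swapAC (φ x)) (φ y))
    swapComponent-boundary {x} {y} adjacent in-x out-y f =
      let acx′ , acy = forbidden⇒isAC (swapAC (φ x)) (φ y) f
          acx = subst T (isAC-swapAC (φ x)) acx′
      in out-y (component-closed {E = acLink φ} {v} in-x (from T-∧ (adjacent , from T-∧ (acx , acy))))

    swapComponent-WR : T (isWR G φ) → T (isWR G (swapComponent v φ))
    swapComponent-WR wr = isWR⁺ compatible
      where
      compatible : ∀ x y → T (G x y) → ¬ T (forbidden (swapComponent v φ x) (swapComponent v φ y))
      compatible x y Gxy with T? (acComponent φ v x) | T? (acComponent φ v y)
      ... | yes in-x | yes in-y
        rewrite swapComponent-in in-x | swapComponent-in in-y | forbidden-swapAC (φ x) (φ y)
        = isWR⁻ wr (from T-∨ (inj₁ Gxy))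
      ... | no out-x | no out-y
        rewrite swapComponent-out out-x | swapComponent-out out-y
        = isWR⁻ wr (from T-∨ (inj₁ Gxy))
      ... | yes in-x | no out-y
        rewrite swapComponent-in in-x | swapComponent-out out-y
        = swapComponent-boundary (from T-∨ (inj₁ Gxy)) in-x out-y
      ... | no out-x | yes in-y
        rewrite swapComponent-out out-x | swapComponent-in in-y | forbidden-sym (φ x) (swapAC (φ y))
        = swapComponent-boundary (from T-∨ (inj₂ Gxy)) in-y out-x

    swapComponent-involutive : swapComponent v (swapComponent v φ) ≗ φ
    swapComponent-involutive x
      rewrite acComponent-resp {v = v} isAC-swapComponent x with acComponent φ v x
    ... | true  = swapAC-involutive (φ x)
    ... | false = refl

  swapComponent-cong : ∀ {v φ ψ} → φ ≗ ψ → swapComponent v φ ≗ swapComponent v ψ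
  swapComponent-cong {v} φ≗ψ x
    rewrite acComponent-resp {v = v} (cong isAC ∘ φ≗ψ) x | φ≗ψ x = refl

  swapComponent-injective : ∀ {v} → Injective _≗_ _≗_ (swapComponent v)
  swapComponent-injective {v} {φ} {ψ} σφ≗σψ x = begin
    φ x                                          ≡⟨ ≡.sym (swapComponent-involutive x) ⟩
    swapComponent v (swapComponent v φ) x        ≡⟨ swapComponent-cong σφ≗σψ x ⟩
    swapComponent v (swapComponent v ψ) x        ≡⟨ swapComponent-involutive x ⟩
    ψ x                                          ∎
    where open ≡.≡-Reasoning

  wrWith : Fin n → Colour → Fin n → Colour → (Fin n → Colour) → Bool
  wrWith u s v t φ = isWR G φ ∧ ((φ u ==ᶜ s) ∧ (φ v ==ᶜ t))

  wrWith-resp-≗ : ∀ u s v t → Respects≗ (wrWith u s v t)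
  wrWith-resp-≗ u s v t φ≗ψ =
    cong₂ _∧_ (isWR-resp-≗ φ≗ψ) (cong₂ _∧_ (cong (_==ᶜ s) (φ≗ψ u)) (cong (_==ᶜ t) (φ≗ψ v)))

  swapComponent-ac⇒aa : ∀ {u v} φ → T (wrWith u a v c φ) → T (wrWith u a v a (swapComponent v φ))
  swapComponent-ac⇒aa {u} {v} φ wr-ac = from T-∧ (swapComponent-WR wr , from T-∧ (colour-a σu≡a , colour-a σv≡a))
    where
    wr : T (isWR G φ)
    wr = proj₁ (to (T-∧ {isWR G φ}) wr-ac)
    colours-uv : T ((φ u ==ᶜ a) ∧ (φ v ==ᶜ c))
    colours-uv = proj₂ (to (T-∧ {isWR G φ}) wr-ac)
    φu≡a : φ u ≡ a
    φu≡a = ==ᶜ⇒≡ (φ u) a (proj₁ (to (T-∧ {φ u ==ᶜ a}) colours-uv))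
    φv≡c : φ v ≡ c
    φv≡c = ==ᶜ⇒≡ (φ v) c (proj₂ (to (T-∧ {φ u ==ᶜ a}) colours-uv))
    colour-a : ∀ {p} → p ≡ a → T (p ==ᶜ a)
    colour-a refl = tt
    σu≡a : swapComponent v φ u ≡ a
    σu≡a = trans (swapComponent-fixes {v} {φ} wr λ φu≡φv → a≢c (trans (≡.sym φu≡a) (trans φu≡φv φv≡c))) φu≡a
      where
      a≢c : a ≢ c
      a≢c ()
    σv≡a : swapComponent v φ v ≡ a
    σv≡a = trans (swapComponent-source {v} {φ}) (cong swapAC φv≡c)

lemma4p1 : (n : ℕ) (H : Graph n) (u v : Fin n) → adj H u v ≡ true →
    wrCount (deleteEdgeAdj H u v) (λ φ → (φ u ==ᶜ a) ∧ (φ v ==ᶜ a))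
      ≥ wrCount (deleteEdgeAdj H u v) (λ φ → (φ u ==ᶜ a) ∧ (φ v ==ᶜ c))
lemma4p1 n H u v _ =
  countB-allMaps-≤ (swapComponent G v) (swapComponent-injective G)
    (wrWith-resp-≗ G u a v c) (wrWith-resp-≗ G u a v a) (swapComponent-ac⇒aa G)
  where
  G = deleteEdgeAdj H u v
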